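{- Let $a,b,c$ be positive integers. Every sequence obtained by permuting the six entries $a,a,b,b,c,c$ is a forbidden pattern; that is, for any such permutation $(a_1,\dots,a_6)$, no path in any skip graph has six consecutive edges that are arcs of sizes $a_1,\dots,a_6$ in this order.
   Context: For a finite set $S$ of positive integers, the skip graph $G(S)$ has vertex set $\mathbb{N}=\{0,1,2,\dots\}$ and, for each $s\in S$ and $j\ge0$, an edge (an $s$-arc) between $2js$ and $(2j+1)s$. An unsigned pattern $[a_1\dots a_n]$ is realizable if there exist signs $\epsilon_k\in\{\pm1\}$ and an integer $T\ge0$ such that with $T_0=T$, $T_k=T_{k-1}+\epsilon_ka_k$, each $T_{k-1}$ is an even multiple of $a_k$ (0 included) when $\epsilon_k=+1$ and an odd multiple of $a_k$ when $\epsilon_k=-1$, and $T_0,\dots,T_n$ are pairwise distinct; equivalently some path with distinct vertices in some skip graph has consecutive edges that are arcs of sizes $a_1,\dots,a_n$. A pattern that is not realizable is forbidden. -}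

module Defs where

open import Data.Nat using (ℕ; _+_; _*_)
open import Data.List using (List; []; _∷_)
open import Data.List.Relation.Unary.Unique.Propositional using (Unique)
open import Data.Product using (∃)

-- An arc of size a traversed from T to T':
--   upward  (sign +1): T = (2j)·a   and T' = T + a
--   downward(sign -1): T = (2j+1)·a and T' = T - a  (stated as T = T' + a)
data Step (a : ℕ) : ℕ → ℕ → Set where
  up   : (j : ℕ) → Step a (2 * j * a) (2 * j * a + a)
  down : (j : ℕ) → Step a ((2 * j + 1) * a) (2 * j * a)

data Walk : ℕ → List ℕ → List ℕ → Set where
  stop : (T : ℕ) → Walk T [] (T ∷ [])
  step : {a T T' : ℕ} {as vs : List ℕ} →
         Step a T T' → Walk T' as vs → Walk T (a ∷ as) (T ∷ vs)

Realizable : List ℕ → Set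
Realizable as = ∃ λ T → ∃ λ vs → Walk T as vs × Unique vs
  where open import Data.Product using (_×_)

Forbidden : List ℕ → Set
Forbidden as = Realizable as → ⊥
  where open import Data.Empty using (⊥)

-- An s-arc joins 2js and 2js + s, so its endpoints are multiples of s, every vertex lies on at most
-- one s-arc (a path never uses two equal arcs in a row), an arc of even size has even endpoints, and
-- an arc of odd size climbs from its even endpoint to its odd one.  If a, b, c are all even, so is
-- every vertex of a realization, and halving it realizes the halved pattern; hence only patterns with
-- an odd size need to be refuted.  A permutation of aabbcc either contains xx, or contains xyxy (then
-- x ∣ y ∣ x along the path, so x = y), or is abacbc, abcabc, abcbac or abcacb up to renaming, the last
-- being the reverse of abcbac.  For these three shapes a case analysis on the parities of a, b, c
-- fixes the directions of the odd arcs, and the path then produces two distinct multiples of some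
-- size that are too close to each other; the key fact is that distinct multiples of d differ by at
-- least d, and by exactly d if they differ by less than 2d.

module Submission where

open import Defs
open import Data.Empty using (⊥; ⊥-elim)
open import Data.Fin as Fin using (Fin; zero; suc; #_)
open import Data.List as List using (List; []; _∷_; length)
open import Data.List.Membership.Propositional using (_∈_)
open import Data.List.Membership.Propositional.Properties using (∈-map⁺)
open import Data.List.Relation.Binary.Permutation.Propositional using (_↭_; ↭-refl; ↭-prep; ↭-swap; ↭-trans; ↭-sym)
open import Data.List.Relation.Binary.Permutation.Propositional.Properties
  using (↭-empty-inv; ↭-length; ∈-resp-↭; drop-mid; ↭-map-inv)
open import Data.List.Relation.Unary.All as All using (All; []; _∷_; all?)
open import Data.List.Relation.Unary.AllPairs using ([]; _∷_)
open import Data.List.Relation.Unary.Any using (here; there)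
open import Data.List.Relation.Unary.Unique.Propositional using (Unique)
import Data.List.Relation.Unary.Unique.Propositional.Properties as Unique
open import Data.Maybe as Maybe using (Maybe; just; nothing; _<∣>_; Is-just; to-witness)
import Data.Maybe.Relation.Unary.Any as Any
open import Data.Nat using (ℕ; zero; suc; _+_; _*_; _<_; _≤_; NonZero; ≢-nonZero⁻¹; >-nonZero⁻¹; z≤n; parity)
open import Data.Nat.Divisibility using (_∣_; divides; ∣⇒≤; >⇒∤; ∣-antisym; ∣m+n∣m⇒∣n; ∣m∣n⇒∣m+n; n∣m*n; ∣-refl)
open import Data.Nat.Induction using (<-wellFounded)
open import Data.Nat.Properties
open import Data.Nat.Tactic.RingSolver using (solve-∀; solve)
open import Data.Parity.Base as ℙ using (0ℙ; 1ℙ)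
open import Data.Parity.Properties as ℙ using (+-homo-+; *-homo-*)
open import Data.Product using (_,_; _×_; ∃; ∃₂; proj₁; proj₂)
open import Data.Sum using (_⊎_; inj₁; inj₂; [_,_]′)
open import Data.Unit using (tt)
open import Function using (_∘_)
open import Induction.WellFounded using (Acc; acc)
open import Relation.Binary.Definitions using (tri<; tri≈; tri>; DecidableEquality)
open import Relation.Binary.PropositionalEquality
open import Relation.Nullary using (¬_; contradiction; yes; no; _×-dec_)
open import Relation.Nullary.Decidable using (toWitness)
open import Relation.Unary using (Decidable)

private variable s d u v w : ℕ

-- Arcs of a skip graph

-- Step, with the start of a descending arc written 2js + s rather than (2j+1)s.
data Arc (s : ℕ) : ℕ → ℕ → Set where
  ascend  : ∀ j → Arc s (2 * j * s) (2 * j * s + s)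
  descend : ∀ j → Arc s (2 * j * s + s) (2 * j * s)

odd-multiple : ∀ j s → 2 * j * s + s ≡ (2 * j + 1) * s
odd-multiple = solve-∀

step⇒arc : Step s u v → Arc s u v
step⇒arc (up j)       = ascend j
step⇒arc {s} (down j) = subst (λ u → Arc s u (2 * j * s)) (odd-multiple j s) (descend j)

arc⇒step : Arc s u v → Step s u v
arc⇒step (ascend j)      = up j
arc⇒step {s} (descend j) = subst (λ u → Step s u (2 * j * s)) (sym (odd-multiple j s)) (down j)

arc-sym : Arc s u v → Arc s v u
arc-sym (ascend j)  = descend j
arc-sym (descend j) = ascend j

arc-∣ˡ : Arc s u v → s ∣ u
arc-∣ˡ (ascend j)  = n∣m*n (2 * j)
arc-∣ˡ (descend j) = ∣m∣n⇒∣m+n (n∣m*n (2 * j)) ∣-refl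

arc-∣ʳ : Arc s u v → s ∣ v
arc-∣ʳ a = arc-∣ˡ (arc-sym a)

arc-length : Arc s u v → v ≡ u + s ⊎ u ≡ v + s
arc-length (ascend j)  = inj₁ refl
arc-length (descend j) = inj₂ refl

∣-difference : d ∣ u → d ∣ v → v ≡ u + s ⊎ u ≡ v + s → d ∣ s
∣-difference d∣u d∣v (inj₁ refl) = ∣m+n∣m⇒∣n d∣v d∣u
∣-difference d∣u d∣v (inj₂ refl) = ∣m+n∣m⇒∣n d∣u d∣v

∣-arc : d ∣ u → d ∣ v → Arc s u v → d ∣ s
∣-arc d∣u d∣v a = ∣-difference d∣u d∣v (arc-length a)

x≢x+s+s : ∀ x s → .{{NonZero s}} → x ≢ x + s + s
x≢x+s+s x s eq = <⇒≢ (m<m+n x (≤-trans (>-nonZero⁻¹ s) (m≤m+n s s))) (trans eq (+-assoc x s s))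

lower-end-even-multiple : .{{NonZero s}} → Arc s u v → v ≡ u + s → ∃ λ j → u ≡ 2 * j * s
lower-end-even-multiple (ascend j)      _  = j , refl
lower-end-even-multiple {s} (descend j) eq = ⊥-elim (x≢x+s+s (2 * j * s) s eq)

upper-end-odd-multiple : .{{NonZero s}} → Arc s u v → u ≡ v + s → ∃ λ j → u ≡ 2 * j * s + s
upper-end-odd-multiple {s} (ascend j) eq = ⊥-elim (x≢x+s+s (2 * j * s) s eq)
upper-end-odd-multiple (descend j)    _  = j , refl

even-multiple≢odd-multiple : ∀ {v} s → .{{NonZero s}} → (∃ λ j → v ≡ 2 * j * s) → ¬ (∃ λ k → v ≡ 2 * k * s + s)
even-multiple≢odd-multiple s (j , refl) (k , eq) =
  even≢odd j k (*-cancelʳ-≡ (2 * j) (suc (2 * k)) s (trans eq (+-comm (2 * k * s) s)))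

arc-unique : ∀ s → .{{NonZero s}} → Arc s v u → Arc s v w → u ≡ w
arc-unique s a₁ a₂ with arc-length a₁ | arc-length a₂
... | inj₁ refl | inj₁ refl = refl
... | inj₂ e₁   | inj₂ e₂   = +-cancelʳ-≡ s _ _ (trans (sym e₁) e₂)
... | inj₁ e₁   | inj₂ e₂   =
  ⊥-elim (even-multiple≢odd-multiple s (lower-end-even-multiple a₁ e₁) (upper-end-odd-multiple a₂ e₂))
... | inj₂ e₁   | inj₁ e₂   =
  ⊥-elim (even-multiple≢odd-multiple s (lower-end-even-multiple a₂ e₂) (upper-end-odd-multiple a₁ e₁))

parity-even-multiple : ∀ j s → parity (2 * j * s) ≡ 0ℙ
parity-even-multiple j s = trans (*-homo-* (2 * j) s) (cong (ℙ._* parity s) (*-homo-* 2 j))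

parity-odd-multiple : ∀ j s → parity (2 * j * s + s) ≡ parity s
parity-odd-multiple j s = trans (+-homo-+ (2 * j * s) s) (cong (ℙ._+ parity s) (parity-even-multiple j s))

even-arcˡ : parity s ≡ 0ℙ → Arc s u v → parity u ≡ 0ℙ
even-arcˡ {s} _  (ascend j)  = parity-even-multiple j s
even-arcˡ {s} ps (descend j) = trans (parity-odd-multiple j s) ps

even-arcʳ : parity s ≡ 0ℙ → Arc s u v → parity v ≡ 0ℙ
even-arcʳ ps a = even-arcˡ ps (arc-sym a)

odd-arc-from-even : parity s ≡ 1ℙ → Arc s u v → parity u ≡ 0ℙ → v ≡ u + s × parity v ≡ 1ℙ
odd-arc-from-even {s} ps (ascend j)  _  = refl , trans (parity-odd-multiple j s) ps
odd-arc-from-even {s} ps (descend j) pu with () ← trans (sym (trans (parity-odd-multiple j s) ps)) pu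

odd-arc-from-odd : parity s ≡ 1ℙ → Arc s u v → parity u ≡ 1ℙ → u ≡ v + s × parity v ≡ 0ℙ
odd-arc-from-odd {s} ps (ascend j)  pu with () ← trans (sym (parity-even-multiple j s)) pu
odd-arc-from-odd {s} ps (descend j) _  = refl , parity-even-multiple j s

odd-arc-between-evens : parity s ≡ 1ℙ → Arc s u v → parity u ≡ 0ℙ → parity v ≡ 0ℙ → ⊥
odd-arc-between-evens ps a pu pv with () ← trans (sym pv) (proj₂ (odd-arc-from-even ps a pu))

even≢odd-parity : ∀ {m n} → parity m ≡ 0ℙ → parity n ≡ 1ℙ → m ≢ n
even≢odd-parity pm pn refl with () ← trans (sym pm) pn

+-right-comm : ∀ x y z → x + y + z ≡ x + z + y
+-right-comm x y z = trans (+-assoc x y z) (trans (cong (x +_) (+-comm y z)) (sym (+-assoc x z y)))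

odd-arcs-same-side : ∀ {p q x m y} → parity p ≡ 1ℙ → parity q ≡ 1ℙ → Arc p x m → Arc q m y →
                     x + p ≡ y + q ⊎ x + q ≡ y + p
odd-arcs-same-side {p} {q} {m = m} pp pq a₁ a₂ with parity m in pm
... | 1ℙ = inj₁ (trans (sym (proj₁ (odd-arc-from-odd pp (arc-sym a₁) pm))) (proj₁ (odd-arc-from-odd pq a₂ pm)))
... | 0ℙ with proj₁ (odd-arc-from-even pp (arc-sym a₁) pm) | proj₁ (odd-arc-from-even pq a₂ pm)
...   | refl | refl = inj₂ (+-right-comm m p q)

-- Multiples of a common divisor

multiple-below⇒0 : ∀ {d k} → d ∣ k → k < d → k ≡ 0
multiple-below⇒0 {k = zero}  _   _   = refl
multiple-below⇒0 {k = suc _} d∣k k<d = contradiction d∣k (>⇒∤ k<d)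

ordered-close-multiples-≡ : ∀ {d x y e f} → d ∣ x → d ∣ y → x + e ≡ y + f → e < d + f → x ≤ y → x ≡ y
ordered-close-multiples-≡ {d} {x} {e = e} {f} d∣x d∣y eq e<d+f x≤y with m≤n⇒∃[o]m+o≡n x≤y
... | k , refl = sym (trans (cong (x +_) k≡0) (+-identityʳ x))
  where
  e≡k+f : e ≡ k + f
  e≡k+f = +-cancelˡ-≡ x e (k + f) (trans eq (+-assoc x k f))
  k≡0 : k ≡ 0
  k≡0 = multiple-below⇒0 (∣m+n∣m⇒∣n d∣y d∣x) (+-cancelʳ-< f k d (subst (_< d + f) e≡k+f e<d+f))

close-multiples-≡ : ∀ {d x y e f} → d ∣ x → d ∣ y → x + e ≡ y + f → e < d + f → f < d + e → x ≡ y
close-multiples-≡ {x = x} {y} d∣x d∣y eq e<d+f f<d+e with ≤-total x y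
... | inj₁ x≤y = ordered-close-multiples-≡ d∣x d∣y eq e<d+f x≤y
... | inj₂ y≤x = sym (ordered-close-multiples-≡ d∣y d∣x (sym eq) f<d+e y≤x)

distinct-multiples-apart : ∀ {d x y e} → d ∣ x → d ∣ y → x + e ≡ y → x ≢ y → d ≤ e
distinct-multiples-apart {d} {x} {y} {e} d∣x d∣y eq x≢y = ≮⇒≥ λ e<d →
  x≢y (close-multiples-≡ d∣x d∣y (trans eq (sym (+-identityʳ y)))
        (≤-trans e<d (≤-reflexive (sym (+-identityʳ d))))
        (≤-trans (≤-<-trans z≤n e<d) (m≤m+n d e)))

next-multiple : ∀ {d x y e} → d ∣ x → d ∣ y → x + e ≡ y → x ≢ y → e < d + d → e ≡ d
next-multiple {d} {x} d∣x d∣y refl x≢y e<2d with ∣m+n∣m⇒∣n d∣y d∣x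
... | divides zero          refl = contradiction (sym (+-identityʳ x)) x≢y
... | divides (suc zero)    refl = +-identityʳ d
... | divides (suc (suc q)) refl = contradiction e<2d (≤⇒≯ (+-monoʳ-≤ d (m≤m+n d (q * d))))

distinct-multiples-k±e⇒k+e≡d : ∀ {d u w e k} → d ∣ u → d ∣ w → u ≢ w → e ≤ k → k < d →
  u + (k + e) ≡ w ⊎ u + k ≡ w + e → k + e ≡ d
distinct-multiples-k±e⇒k+e≡d {d} d∣u d∣w u≢w e≤k k<d (inj₁ eq) =
  next-multiple d∣u d∣w eq u≢w (+-mono-< k<d (≤-<-trans e≤k k<d))
distinct-multiples-k±e⇒k+e≡d {d} {e = e} {k} d∣u d∣w u≢w e≤k k<d (inj₂ eq) = contradiction
  (close-multiples-≡ d∣u d∣w eq (≤-trans k<d (m≤m+n d e)) (<-≤-trans (≤-<-trans e≤k k<d) (m≤m+n d k)))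
  u≢w

odd-arcs-between-multiples : ∀ {d p q x m y} → .{{NonZero p}} → .{{NonZero q}} →
  parity p ≡ 1ℙ → parity q ≡ 1ℙ → p ≤ d → q ≤ d → d ∣ x → d ∣ y → Arc p x m → Arc q m y → x ≡ y
odd-arcs-between-multiples {d} {p} {q} pp pq p≤d q≤d d∣x d∣y a₁ a₂ =
  [ (λ eq → close-multiples-≡ d∣x d∣y eq (below p≤d) (below q≤d))
  , (λ eq → close-multiples-≡ d∣x d∣y eq (below q≤d) (below p≤d))
  ]′ (odd-arcs-same-side pp pq a₁ a₂)
  where
  below : ∀ {r s} → .{{NonZero s}} → r ≤ d → r < d + s
  below {s = s} r≤d = ≤-<-trans r≤d (m<m+n d (>-nonZero⁻¹ s))

shift-then-arc⇒k+e≡d : ∀ {d u w x e k} → d ∣ u → d ∣ w → u ≢ w → e ≤ k → k < d →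
  u + k ≡ x → Arc e x w → k + e ≡ d
shift-then-arc⇒k+e≡d {u = u} {e = e} {k} d∣u d∣w u≢w e≤k k<d refl a =
  distinct-multiples-k±e⇒k+e≡d d∣u d∣w u≢w e≤k k<d (regroup (arc-length a))
  where
  regroup : ∀ {w} → w ≡ u + k + e ⊎ u + k ≡ w + e → u + (k + e) ≡ w ⊎ u + k ≡ w + e
  regroup (inj₁ refl) = inj₁ (sym (+-assoc u k e))
  regroup (inj₂ eq)   = inj₂ eq

positive-gap : ∀ {m n} → .{{NonZero m}} → m < n → ∃ λ k → m + k ≡ n × k < n
positive-gap {m} m<n with m≤n⇒∃[o]m+o≡n (<⇒≤ m<n)
... | k , refl = k , refl , m<n+m k (>-nonZero⁻¹ m)

+-cancel-gap : ∀ {x y s k a} → x + a ≡ y + s → s + k ≡ a → x + k ≡ y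
+-cancel-gap {x} {y} {s} {k} eq refl =
  +-cancelʳ-≡ s (x + k) y (trans (trans (+-assoc x k s) (cong (x +_) (+-comm k s))) eq)

gap-sizes-coincide : ∀ {e m d} k → k + e ≡ d → m + k ≡ d → e ≡ m
gap-sizes-coincide {e} {m} k k+e≡d m+k≡d = +-cancelˡ-≡ k e m (trans k+e≡d (trans (sym m+k≡d) (+-comm m k)))

translate : ∀ {x y u v s e} → x ≡ u + s → y ≡ v + s → v ≡ u + e ⊎ u ≡ v + e → y ≡ x + e ⊎ x ≡ y + e
translate {u = u} {s = s} {e} refl refl (inj₁ refl) = inj₁ (+-right-comm u e s)
translate {v = v} {s = s} {e} refl refl (inj₂ refl) = inj₂ (+-right-comm v e s)

valley-span : ∀ {x y z w b c} → x ≡ y + b → z ≡ y + c → z ≡ w + b → x + c ≡ w + (b + b)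
valley-span {y = y} {w = w} {b} {c} refl refl eq =
  trans (+-right-comm y b c) (trans (cong (_+ b) eq) (+-assoc w b b))

peak-span : ∀ {x y z w b c} → y ≡ x + b → y ≡ z + c → w ≡ z + b → w + c ≡ x + (b + b)
peak-span {x} {z = z} {b = b} {c} refl eq refl =
  trans (+-right-comm z b c) (trans (cong (_+ b) (sym eq)) (+-assoc x b b))

zigzag-from-valley : ∀ {x₀ x₁ x₂ x₃ x₄ x₅ x₆ a b c} →
  x₁ ≡ x₀ + a → x₁ ≡ x₂ + b → x₃ ≡ x₂ + c → x₃ ≡ x₄ + a → x₅ ≡ x₄ + b → x₅ ≡ x₆ + c → x₀ ≡ x₆
zigzag-from-valley {x₀} {x₂ = x₂} {x₄ = x₄} {x₆ = x₆} {a} {b} {c} refl e₁₂ refl e₃₄ refl e₅₆ =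
  +-cancelʳ-≡ (x₂ + x₄ + (a + b + c)) x₀ x₆ (begin
    x₀ + (x₂ + x₄ + (a + b + c))  ≡⟨ solve (x₀ List.∷ x₂ List.∷ x₄ List.∷ a List.∷ b List.∷ c List.∷ List.[]) ⟩
    x₀ + a + (x₂ + c) + (x₄ + b)  ≡⟨ cong₂ _+_ (cong₂ _+_ e₁₂ e₃₄) e₅₆ ⟩
    x₂ + b + (x₄ + a) + (x₆ + c)  ≡⟨ solve (x₆ List.∷ x₂ List.∷ x₄ List.∷ a List.∷ b List.∷ c List.∷ List.[]) ⟩
    x₆ + (x₂ + x₄ + (a + b + c))  ∎)
  where open ≡-Reasoning

zigzag-from-peak : ∀ {x₀ x₁ x₂ x₃ x₄ x₅ x₆ a b c} →
  x₀ ≡ x₁ + a → x₂ ≡ x₁ + b → x₂ ≡ x₃ + c → x₄ ≡ x₃ + a → x₄ ≡ x₅ + b → x₆ ≡ x₅ + c → x₀ ≡ x₆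
zigzag-from-peak {x₁ = x₁} {x₃ = x₃} {x₅ = x₅} {a = a} {b} {c} refl refl e₂₃ refl e₄₅ refl =
  +-cancelʳ-≡ (x₃ + b) (x₁ + a) (x₅ + c) (begin
    x₁ + a + (x₃ + b)   ≡⟨ solve (x₁ List.∷ x₃ List.∷ a List.∷ b List.∷ List.[]) ⟩
    x₁ + b + (x₃ + a)   ≡⟨ cong₂ _+_ e₂₃ e₄₅ ⟩
    x₃ + c + (x₅ + b)   ≡⟨ solve (x₃ List.∷ x₅ List.∷ b List.∷ c List.∷ List.[]) ⟩
    x₅ + c + (x₃ + b)   ∎)
  where open ≡-Reasoning

-- Short forbidden patterns and halving

forbidden-cons : ∀ {x xs} → Forbidden xs → Forbidden (x ∷ xs)
forbidden-cons ¬xs (_ , _ ∷ _ , step _ w , _ ∷ unique) = ¬xs (_ , _ , w , unique)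

walk-head : ∀ {T as vs} → Walk T as vs → ∃ λ vs′ → vs ≡ T ∷ vs′
walk-head (stop _)   = _ , refl
walk-head (step _ _) = _ , refl

forbidden-repeat : ∀ {x xs} → .{{NonZero x}} → Forbidden (x ∷ x ∷ xs)
forbidden-repeat {x} (_ , _ , step s₁ (step s₂ w) , unique) with walk-head w | unique
... | _ , refl | (_ ∷ t0≢t2 ∷ _) ∷ _ = t0≢t2 (arc-unique x (arc-sym (step⇒arc s₁)) (step⇒arc s₂))

alternation-collapses : ∀ {x y t0 t1 t2 t3 t4} → .{{NonZero x}} →
  Arc x t0 t1 → Arc y t1 t2 → Arc x t2 t3 → Arc y t3 t4 → t1 ≡ t3
alternation-collapses {x} {y} a₁ a₂ a₃ a₄ = arc-unique x (arc-sym (subst (λ z → Arc z _ _) (sym x≡y) a₂)) a₃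
  where
  x≡y : x ≡ y
  x≡y = ∣-antisym (∣-arc (arc-∣ʳ a₁) (arc-∣ˡ a₃) a₂) (∣-arc (arc-∣ʳ a₂) (arc-∣ˡ a₄) a₃)

forbidden-alternation : ∀ {x y xs} → .{{NonZero x}} → Forbidden (x ∷ y ∷ x ∷ y ∷ xs)
forbidden-alternation (_ , _ , step s₁ (step s₂ (step s₃ (step s₄ _))) , _ ∷ (_ ∷ t1≢t3 ∷ _) ∷ _) =
  t1≢t3 (alternation-collapses (step⇒arc s₁) (step⇒arc s₂) (step⇒arc s₃) (step⇒arc s₄))

step-halve : ∀ {s u v} → Step (2 * s) u v → ∃₂ λ u′ v′ → u ≡ 2 * u′ × v ≡ 2 * v′ × Step s u′ v′
step-halve {s} (up j)   = _ , _ , lower j s , upper j s , up j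
  where
  lower : ∀ j s → 2 * j * (2 * s) ≡ 2 * (2 * j * s)
  lower = solve-∀
  upper : ∀ j s → 2 * j * (2 * s) + 2 * s ≡ 2 * (2 * j * s + s)
  upper = solve-∀
step-halve {s} (down j) = _ , _ , upper j s , lower j s , down j
  where
  upper : ∀ j s → (2 * j + 1) * (2 * s) ≡ 2 * ((2 * j + 1) * s)
  upper = solve-∀
  lower : ∀ j s → 2 * j * (2 * s) ≡ 2 * (2 * j * s)
  lower = solve-∀

walk-halve : ∀ {T as vs} → Walk (2 * T) (List.map (2 *_) as) vs →
             ∃ λ vs′ → vs ≡ List.map (2 *_) vs′ × Walk T as vs′
walk-halve {T} {[]}     (stop _)   = T ∷ [] , refl , stop T
walk-halve {T} {a ∷ as} (step st w) with step-halve {a} st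
... | u′ , _ , 2T≡2u′ , refl , st′ with *-cancelˡ-≡ T u′ 2 2T≡2u′ | walk-halve w
...   | refl | vs′ , refl , w′ = T ∷ vs′ , refl , step st′ w′

realizable-halve : ∀ {as} → Realizable (List.map (2 *_) as) → Realizable as
realizable-halve {[]}     _ = 0 , 0 ∷ [] , stop 0 , [] ∷ []
realizable-halve {a ∷ as} (_ , _ , w@(step st _) , unique) with step-halve {a} st
... | u′ , _ , refl , _ , _ with walk-halve {u′} w
...   | vs′ , vs≡2vs′ , w′ = u′ , vs′ , w′ , Unique.map⁻ (subst Unique vs≡2vs′ unique)

even⇒double : ∀ n → parity n ≡ 0ℙ → ∃ λ m → n ≡ 2 * m
even⇒double zero          _ = 0 , refl
even⇒double (suc (suc n)) p with even⇒double n p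
... | m , refl = suc m , sym (*-suc 2 m)

nonZero-half : ∀ n → .{{NonZero (2 * n)}} → NonZero n
nonZero-half zero    {{nz}} = ⊥-elim (≢-nonZero⁻¹ 0 {{nz}} refl)
nonZero-half (suc n)        = _

AllEven : ℕ → ℕ → ℕ → Set
AllEven a b c = parity a ≡ 0ℙ × parity b ≡ 0ℙ × parity c ≡ 0ℙ

n<2*n : ∀ n → .{{NonZero n}} → n < 2 * n
n<2*n n = m<m+n n (≤-trans (>-nonZero⁻¹ n) (m≤m+n n 0))

halving-descent : (shape : ℕ → ℕ → ℕ → List ℕ) →
  (∀ {a b c} → shape (2 * a) (2 * b) (2 * c) ≡ List.map (2 *_) (shape a b c)) →
  (∀ {a b c} → .{{NonZero a}} → .{{NonZero b}} → .{{NonZero c}} → ¬ AllEven a b c → Forbidden (shape a b c)) →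
  ∀ {a b c} → .{{NonZero a}} → .{{NonZero b}} → .{{NonZero c}} → Forbidden (shape a b c)
halving-descent shape shape-double odd-forbidden {a} {b} {c} = go a b c (<-wellFounded a)
  where
  go : ∀ a b c → .{{NonZero a}} → .{{NonZero b}} → .{{NonZero c}} → Acc _<_ a → Forbidden (shape a b c)
  go a b c (acc rec) with parity a ℙ.≟ 0ℙ ×-dec parity b ℙ.≟ 0ℙ ×-dec parity c ℙ.≟ 0ℙ
  ... | no some-odd = odd-forbidden some-odd
  ... | yes (ea , eb , ec) with even⇒double a ea | even⇒double b eb | even⇒double c ec
  ...   | a′ , refl | b′ , refl | c′ , refl =
    go a′ b′ c′ {{nonZero-half a′}} {{nonZero-half b′}} {{nonZero-half c′}} (rec (n<2*n a′ {{nonZero-half a′}}))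
    ∘ realizable-halve ∘ subst Realizable shape-double

record Path6 (x₁ x₂ x₃ x₄ x₅ x₆ : ℕ) : Set where
  field
    t0 t1 t2 t3 t4 t5 t6 : ℕ
    s1 : Arc x₁ t0 t1
    s2 : Arc x₂ t1 t2
    s3 : Arc x₃ t2 t3
    s4 : Arc x₄ t3 t4
    s5 : Arc x₅ t4 t5
    s6 : Arc x₆ t5 t6
    t0≢t1 : t0 ≢ t1
    t0≢t2 : t0 ≢ t2
    t0≢t3 : t0 ≢ t3
    t0≢t4 : t0 ≢ t4
    t0≢t5 : t0 ≢ t5
    t0≢t6 : t0 ≢ t6
    t1≢t2 : t1 ≢ t2
    t1≢t3 : t1 ≢ t3
    t1≢t4 : t1 ≢ t4
    t1≢t5 : t1 ≢ t5
    t1≢t6 : t1 ≢ t6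
    t2≢t3 : t2 ≢ t3
    t2≢t4 : t2 ≢ t4
    t2≢t5 : t2 ≢ t5
    t2≢t6 : t2 ≢ t6
    t3≢t4 : t3 ≢ t4
    t3≢t5 : t3 ≢ t5
    t3≢t6 : t3 ≢ t6
    t4≢t5 : t4 ≢ t5
    t4≢t6 : t4 ≢ t6
    t5≢t6 : t5 ≢ t6

realizable⇒path6 : ∀ {x₁ x₂ x₃ x₄ x₅ x₆} → Realizable (x₁ ∷ x₂ ∷ x₃ ∷ x₄ ∷ x₅ ∷ x₆ ∷ []) → Path6 x₁ x₂ x₃ x₄ x₅ x₆
realizable⇒path6 (_ , _ , step s1 (step s2 (step s3 (step s4 (step s5 (step s6 (stop _)))))) ,
                  (d01 ∷ d02 ∷ d03 ∷ d04 ∷ d05 ∷ d06 ∷ []) ∷ (d12 ∷ d13 ∷ d14 ∷ d15 ∷ d16 ∷ []) ∷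
                  (d23 ∷ d24 ∷ d25 ∷ d26 ∷ []) ∷ (d34 ∷ d35 ∷ d36 ∷ []) ∷ (d45 ∷ d46 ∷ []) ∷ (d56 ∷ []) ∷ [] ∷ []) =
  record
    { s1 = step⇒arc s1 ; s2 = step⇒arc s2 ; s3 = step⇒arc s3
    ; s4 = step⇒arc s4 ; s5 = step⇒arc s5 ; s6 = step⇒arc s6
    ; t0≢t1 = d01 ; t0≢t2 = d02 ; t0≢t3 = d03 ; t0≢t4 = d04 ; t0≢t5 = d05 ; t0≢t6 = d06
    ; t1≢t2 = d12 ; t1≢t3 = d13 ; t1≢t4 = d14 ; t1≢t5 = d15 ; t1≢t6 = d16
    ; t2≢t3 = d23 ; t2≢t4 = d24 ; t2≢t5 = d25 ; t2≢t6 = d26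
    ; t3≢t4 = d34 ; t3≢t5 = d35 ; t3≢t6 = d36
    ; t4≢t5 = d45 ; t4≢t6 = d46
    ; t5≢t6 = d56
    }

path6⇒realizable : ∀ {x₁ x₂ x₃ x₄ x₅ x₆} → Path6 x₁ x₂ x₃ x₄ x₅ x₆ → Realizable (x₁ ∷ x₂ ∷ x₃ ∷ x₄ ∷ x₅ ∷ x₆ ∷ [])
path6⇒realizable p =
  t0 , _ ,
  step (arc⇒step s1) (step (arc⇒step s2) (step (arc⇒step s3) (step (arc⇒step s4) (step (arc⇒step s5) (step (arc⇒step s6) (stop t6)))))) ,
  (t0≢t1 ∷ t0≢t2 ∷ t0≢t3 ∷ t0≢t4 ∷ t0≢t5 ∷ t0≢t6 ∷ []) ∷ (t1≢t2 ∷ t1≢t3 ∷ t1≢t4 ∷ t1≢t5 ∷ t1≢t6 ∷ []) ∷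
  (t2≢t3 ∷ t2≢t4 ∷ t2≢t5 ∷ t2≢t6 ∷ []) ∷ (t3≢t4 ∷ t3≢t5 ∷ t3≢t6 ∷ []) ∷ (t4≢t5 ∷ t4≢t6 ∷ []) ∷ (t5≢t6 ∷ []) ∷ [] ∷ []
  where open Path6 p

reverse6 : ∀ {x₁ x₂ x₃ x₄ x₅ x₆} → Path6 x₁ x₂ x₃ x₄ x₅ x₆ → Path6 x₆ x₅ x₄ x₃ x₂ x₁
reverse6 p = record
  { t0 = t6 ; t1 = t5 ; t2 = t4 ; t3 = t3 ; t4 = t2 ; t5 = t1 ; t6 = t0
  ; s1 = arc-sym s6 ; s2 = arc-sym s5 ; s3 = arc-sym s4
  ; s4 = arc-sym s3 ; s5 = arc-sym s2 ; s6 = arc-sym s1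
  ; t0≢t1 = ≢-sym t5≢t6 ; t0≢t2 = ≢-sym t4≢t6 ; t0≢t3 = ≢-sym t3≢t6
  ; t0≢t4 = ≢-sym t2≢t6 ; t0≢t5 = ≢-sym t1≢t6 ; t0≢t6 = ≢-sym t0≢t6
  ; t1≢t2 = ≢-sym t4≢t5 ; t1≢t3 = ≢-sym t3≢t5 ; t1≢t4 = ≢-sym t2≢t5 ; t1≢t5 = ≢-sym t1≢t5
  ; t1≢t6 = ≢-sym t0≢t5
  ; t2≢t3 = ≢-sym t3≢t4 ; t2≢t4 = ≢-sym t2≢t4 ; t2≢t5 = ≢-sym t1≢t4 ; t2≢t6 = ≢-sym t0≢t4
  ; t3≢t4 = ≢-sym t2≢t3 ; t3≢t5 = ≢-sym t1≢t3 ; t3≢t6 = ≢-sym t0≢t3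
  ; t4≢t5 = ≢-sym t1≢t2 ; t4≢t6 = ≢-sym t0≢t2
  ; t5≢t6 = ≢-sym t0≢t1
  }
  where open Path6 p

-- The shapes abacbc, abcabc and abcbac

abacbc-odd-forbidden : ∀ {a b c} → .{{NonZero a}} → .{{NonZero b}} → .{{NonZero c}} →
                       ¬ AllEven a b c → ¬ Path6 a b a c b c
abacbc-odd-forbidden {a} {b} {c} not-even p with parity a in pa | parity b in pb | parity c in pc
... | 0ℙ | 0ℙ | 0ℙ = not-even (refl , refl , refl)
... | 1ℙ | 0ℙ | 0ℙ = odd-arc-between-evens pa s3 (even-arcʳ pb s2) (even-arcˡ pc s4) where open Path6 p
... | 0ℙ | 1ℙ | _  = odd-arc-between-evens pb s2 (even-arcʳ pa s1) (even-arcˡ pa s3) where open Path6 p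
... | 0ℙ | 0ℙ | 1ℙ = odd-arc-between-evens pc s4 (even-arcʳ pa s3) (even-arcˡ pb s5) where open Path6 p
... | 1ℙ | 1ℙ | 0ℙ = odd-arc-between-evens pb s5 (even-arcʳ pc s4) (even-arcˡ pc s6) where open Path6 p
... | 1ℙ | _  | 1ℙ = t2≢t4 (odd-arcs-between-multiples pa pc a≤b c≤b (arc-∣ʳ s2) (arc-∣ˡ s5) s3 s4)
  where
  open Path6 p
  a≤b : a ≤ b
  a≤b = ∣⇒≤ (∣-arc (arc-∣ʳ s1) (arc-∣ˡ s3) s2)
  c≤b : c ≤ b
  c≤b = ∣⇒≤ (∣-arc (arc-∣ʳ s4) (arc-∣ˡ s6) s5)

-- With one size even, the two odd arcs leaving a peak have sizes m and m + k; the even arc, of size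
-- e ≤ k, at the end of the shorter one puts two distinct multiples of m + k at distance k ± e, which
-- forces e = m, of the wrong parity.
module _ {a b c : ℕ} .{{_ : NonZero a}} .{{_ : NonZero b}} .{{_ : NonZero c}} (p : Path6 a b c a b c)
         (pa : parity a ≡ 1ℙ) (pb : parity b ≡ 1ℙ) (pc : parity c ≡ 0ℙ) where
  open Path6 p

  private
    t1≡t2+b : t1 ≡ t2 + b
    t1≡t2+b = proj₁ (odd-arc-from-even pb (arc-sym s2) (even-arcˡ pc s3))

    t1≡t0+a : t1 ≡ t0 + a
    t1≡t0+a = proj₁ (odd-arc-from-odd pa (arc-sym s1) (proj₂ (odd-arc-from-even pb (arc-sym s2) (even-arcˡ pc s3))))

    t4≡t3+a : t4 ≡ t3 + a
    t4≡t3+a = proj₁ (odd-arc-from-even pa s4 (even-arcʳ pc s3))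

    t4≡t5+b : t4 ≡ t5 + b
    t4≡t5+b = proj₁ (odd-arc-from-odd pb s5 (proj₂ (odd-arc-from-even pa s4 (even-arcʳ pc s3))))

  abcabc-odd-odd-even : ⊥
  abcabc-odd-odd-even with <-cmp a b
  ... | tri≈ _ a≡b _ = t3≢t5 (+-cancelʳ-≡ a t3 t5 (trans (sym t4≡t3+a) (trans t4≡t5+b (cong (t5 +_) (sym a≡b)))))
  ... | tri< a<b _ _ with positive-gap a<b
  ...   | k , a+k≡b , k<b = even≢odd-parity pc pa (gap-sizes-coincide k k+c≡b a+k≡b)
    where
    t5+k≡t3 : t5 + k ≡ t3
    t5+k≡t3 = +-cancel-gap (trans (sym t4≡t5+b) t4≡t3+a) a+k≡b
    k+c≡b : k + c ≡ b
    k+c≡b = shift-then-arc⇒k+e≡d (arc-∣ʳ s5) (arc-∣ʳ s2) (≢-sym t2≢t5)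
              (distinct-multiples-apart (arc-∣ˡ s6) (arc-∣ʳ s3) t5+k≡t3 (≢-sym t3≢t5)) k<b t5+k≡t3 (arc-sym s3)
  abcabc-odd-odd-even | tri> _ _ b<a with positive-gap b<a
  ...   | k , b+k≡a , k<a = even≢odd-parity pc pb (gap-sizes-coincide k k+c≡a b+k≡a)
    where
    c≤k : c ≤ k
    c≤k = distinct-multiples-apart (arc-∣ʳ s3) (arc-∣ˡ s6) (+-cancel-gap (trans (sym t4≡t3+a) t4≡t5+b) b+k≡a) t3≢t5
    k+c≡a : k + c ≡ a
    k+c≡a = shift-then-arc⇒k+e≡d (arc-∣ˡ s1) (arc-∣ˡ s4) t0≢t3 c≤k k<a
              (+-cancel-gap (trans (sym t1≡t0+a) t1≡t2+b) b+k≡a) s3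

module _ {a b c : ℕ} .{{_ : NonZero a}} .{{_ : NonZero b}} .{{_ : NonZero c}} (p : Path6 a b c a b c)
         (pa : parity a ≡ 1ℙ) (pb : parity b ≡ 0ℙ) (pc : parity c ≡ 1ℙ) where
  open Path6 p

  private
    t3≡t2+c : t3 ≡ t2 + c
    t3≡t2+c = proj₁ (odd-arc-from-even pc s3 (even-arcʳ pb s2))

    t3≡t4+a : t3 ≡ t4 + a
    t3≡t4+a = proj₁ (odd-arc-from-odd pa s4 (proj₂ (odd-arc-from-even pc s3 (even-arcʳ pb s2))))

  abcabc-odd-even-odd : ⊥
  abcabc-odd-even-odd with <-cmp a c
  ... | tri≈ _ a≡c _ = t2≢t4 (+-cancelʳ-≡ c t2 t4 (trans (sym t3≡t2+c) (trans t3≡t4+a (cong (t4 +_) a≡c))))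
  ... | tri< a<c _ _ with positive-gap a<c
  ...   | k , a+k≡c , k<c = even≢odd-parity pb pa (gap-sizes-coincide k k+b≡c a+k≡c)
    where
    t2+k≡t4 : t2 + k ≡ t4
    t2+k≡t4 = +-cancel-gap (trans (sym t3≡t2+c) t3≡t4+a) a+k≡c
    k+b≡c : k + b ≡ c
    k+b≡c = shift-then-arc⇒k+e≡d (arc-∣ˡ s3) (arc-∣ˡ s6) t2≢t5
              (distinct-multiples-apart (arc-∣ʳ s2) (arc-∣ˡ s5) t2+k≡t4 t2≢t4) k<c t2+k≡t4 s5
  abcabc-odd-even-odd | tri> _ _ c<a with positive-gap c<a
  ...   | k , c+k≡a , k<a = even≢odd-parity pb pc (gap-sizes-coincide k k+b≡a c+k≡a)
    where
    t4+k≡t2 : t4 + k ≡ t2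
    t4+k≡t2 = +-cancel-gap (trans (sym t3≡t4+a) t3≡t2+c) c+k≡a
    k+b≡a : k + b ≡ a
    k+b≡a = shift-then-arc⇒k+e≡d (arc-∣ʳ s4) (arc-∣ʳ s1) (≢-sym t1≢t4)
              (distinct-multiples-apart (arc-∣ˡ s5) (arc-∣ʳ s2) t4+k≡t2 (≢-sym t2≢t4)) k<a t4+k≡t2 (arc-sym s2)

module _ {a b c : ℕ} (p : Path6 a b c a b c) (pa : parity a ≡ 1ℙ) (pb : parity b ≡ 1ℙ) (pc : parity c ≡ 1ℙ) where
  open Path6 p

  abcabc-all-odd : ⊥
  abcabc-all-odd with parity t0 in p0
  ... | 0ℙ = t0≢t6 (zigzag-from-valley (proj₁ f₁) (proj₁ f₂) (proj₁ f₃) (proj₁ f₄) (proj₁ f₅) (proj₁ f₆))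
    where
    f₁ : t1 ≡ t0 + a × parity t1 ≡ 1ℙ
    f₁ = odd-arc-from-even pa s1 p0
    f₂ : t1 ≡ t2 + b × parity t2 ≡ 0ℙ
    f₂ = odd-arc-from-odd pb s2 (proj₂ f₁)
    f₃ : t3 ≡ t2 + c × parity t3 ≡ 1ℙ
    f₃ = odd-arc-from-even pc s3 (proj₂ f₂)
    f₄ : t3 ≡ t4 + a × parity t4 ≡ 0ℙ
    f₄ = odd-arc-from-odd pa s4 (proj₂ f₃)
    f₅ : t5 ≡ t4 + b × parity t5 ≡ 1ℙ
    f₅ = odd-arc-from-even pb s5 (proj₂ f₄)
    f₆ : t5 ≡ t6 + c × parity t6 ≡ 0ℙ
    f₆ = odd-arc-from-odd pc s6 (proj₂ f₅)
  ... | 1ℙ = t0≢t6 (zigzag-from-peak {x₁ = t1} {x₃ = t3} {x₅ = t5} (proj₁ f₁) (proj₁ f₂) (proj₁ f₃) (proj₁ f₄) (proj₁ f₅) (proj₁ f₆))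
    where
    f₁ : t0 ≡ t1 + a × parity t1 ≡ 0ℙ
    f₁ = odd-arc-from-odd pa s1 p0
    f₂ : t2 ≡ t1 + b × parity t2 ≡ 1ℙ
    f₂ = odd-arc-from-even pb s2 (proj₂ f₁)
    f₃ : t2 ≡ t3 + c × parity t3 ≡ 0ℙ
    f₃ = odd-arc-from-odd pc s3 (proj₂ f₂)
    f₄ : t4 ≡ t3 + a × parity t4 ≡ 1ℙ
    f₄ = odd-arc-from-even pa s4 (proj₂ f₃)
    f₅ : t4 ≡ t5 + b × parity t5 ≡ 0ℙ
    f₅ = odd-arc-from-odd pb s5 (proj₂ f₄)
    f₆ : t6 ≡ t5 + c × parity t6 ≡ 1ℙ
    f₆ = odd-arc-from-even pc s6 (proj₂ f₅)

abcabc-odd-forbidden : ∀ {a b c} → .{{NonZero a}} → .{{NonZero b}} → .{{NonZero c}} →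
                       ¬ AllEven a b c → ¬ Path6 a b c a b c
abcabc-odd-forbidden {a} {b} {c} not-even p with parity a in pa | parity b in pb | parity c in pc
... | 0ℙ | 0ℙ | 0ℙ = not-even (refl , refl , refl)
... | 1ℙ | 0ℙ | 0ℙ = odd-arc-between-evens pa s4 (even-arcʳ pc s3) (even-arcˡ pb s5) where open Path6 p
... | 0ℙ | 1ℙ | 0ℙ = odd-arc-between-evens pb s2 (even-arcʳ pa s1) (even-arcˡ pc s3) where open Path6 p
... | 0ℙ | 0ℙ | 1ℙ = odd-arc-between-evens pc s3 (even-arcʳ pb s2) (even-arcˡ pa s4) where open Path6 p
... | 1ℙ | 1ℙ | 0ℙ = abcabc-odd-odd-even p pa pb pc
... | 1ℙ | 0ℙ | 1ℙ = abcabc-odd-even-odd p pa pb pc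
... | 0ℙ | 1ℙ | 1ℙ = abcabc-odd-odd-even (reverse6 p) pc pb pa
... | 1ℙ | 1ℙ | 1ℙ = abcabc-all-odd p pa pb pc

abcbac-core : ∀ {a b c x y u v} → .{{NonZero a}} → .{{NonZero b}} → b ≤ c →
  c ∣ x → c ∣ y → x ≢ y → a ∣ u → a ∣ v → u ≢ v → x + a ≡ y + b → u + c ≡ v + (b + b) → ⊥
abcbac-core {a} {b} {c} b≤c c∣x c∣y x≢y a∣u a∣v u≢v x+a≡y+b u+c≡v+2b with <-cmp a b
... | tri≈ _ refl _ = x≢y (+-cancelʳ-≡ a _ _ x+a≡y+b)
... | tri< a<b _ _ with positive-gap a<b
...   | k , a+k≡b , k<b = <⇒≱ (<-≤-trans k<b b≤c)
                            (distinct-multiples-apart c∣y c∣x (+-cancel-gap (sym x+a≡y+b) a+k≡b) (≢-sym x≢y))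
abcbac-core {a} {b} {c} b≤c c∣x c∣y x≢y a∣u a∣v u≢v x+a≡y+b u+c≡v+2b | tri> _ _ b<a with positive-gap b<a
...   | k , b+k≡a , k<a = u≢v (close-multiples-≡ a∣u a∣v u+c≡v+2b (<-≤-trans c<a (m≤m+n a (b + b))) (+-mono-<-≤ b<a b≤c))
  where
  c<a : c < a
  c<a = ≤-<-trans (distinct-multiples-apart c∣x c∣y (+-cancel-gap x+a≡y+b b+k≡a) x≢y) k<a

module _ {a b c : ℕ} .{{_ : NonZero a}} .{{_ : NonZero b}} .{{_ : NonZero c}} (p : Path6 a b c b a c)
         (pa : parity a ≡ 1ℙ) (pb : parity b ≡ 1ℙ) where
  open Path6 p

  private
    b≤c : b ≤ c
    b≤c = ∣⇒≤ (∣-arc (arc-∣ʳ s2) (arc-∣ˡ s4) s3)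

  abcbac-odd-odd-even : parity c ≡ 0ℙ → ⊥
  abcbac-odd-odd-even pc = t3≢t5 (odd-arcs-between-multiples pb pa b≤c a≤c (arc-∣ʳ s3) (arc-∣ˡ s6) s4 s5)
    where
    t1≡t2+b : t1 ≡ t2 + b
    t1≡t2+b = proj₁ (odd-arc-from-even pb (arc-sym s2) (even-arcˡ pc s3))
    t4≡t3+b : t4 ≡ t3 + b
    t4≡t3+b = proj₁ (odd-arc-from-even pb s4 (even-arcʳ pc s3))
    a≤c : a ≤ c
    a≤c = ∣⇒≤ (∣-difference (arc-∣ʳ s1) (arc-∣ˡ s5) (translate t1≡t2+b t4≡t3+b (arc-length s3)))

  abcbac-all-odd : parity c ≡ 1ℙ → ⊥
  abcbac-all-odd pc with parity t2 in p2
  ... | 0ℙ = abcbac-core b≤c (arc-∣ʳ s3) (arc-∣ˡ s6) t3≢t5 (arc-∣ʳ s1) (arc-∣ˡ s5) t1≢t4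
               (trans (cong (_+ a) (proj₁ f₄)) (trans (+-right-comm t4 b a) (cong (_+ b) (sym (proj₁ f₅)))))
               (valley-span (proj₁ f₂) (proj₁ f₃) (proj₁ f₄))
    where
    f₂ : t1 ≡ t2 + b × parity t1 ≡ 1ℙ
    f₂ = odd-arc-from-even pb (arc-sym s2) p2
    f₃ : t3 ≡ t2 + c × parity t3 ≡ 1ℙ
    f₃ = odd-arc-from-even pc s3 p2
    f₄ : t3 ≡ t4 + b × parity t4 ≡ 0ℙ
    f₄ = odd-arc-from-odd pb s4 (proj₂ f₃)
    f₅ : t5 ≡ t4 + a × parity t5 ≡ 1ℙ
    f₅ = odd-arc-from-even pa s5 (proj₂ f₄)
  ... | 1ℙ = abcbac-core b≤c (arc-∣ˡ s6) (arc-∣ʳ s3) (≢-sym t3≢t5) (arc-∣ˡ s5) (arc-∣ʳ s1) (≢-sym t1≢t4)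
               (trans (sym (proj₁ f₅)) (proj₁ f₄))
               (peak-span (proj₁ f₂) (proj₁ f₃) (proj₁ f₄))
    where
    f₂ : t2 ≡ t1 + b × parity t1 ≡ 0ℙ
    f₂ = odd-arc-from-odd pb (arc-sym s2) p2
    f₃ : t2 ≡ t3 + c × parity t3 ≡ 0ℙ
    f₃ = odd-arc-from-odd pc s3 p2
    f₄ : t4 ≡ t3 + b × parity t4 ≡ 1ℙ
    f₄ = odd-arc-from-even pb s4 (proj₂ f₃)
    f₅ : t4 ≡ t5 + a × parity t5 ≡ 0ℙ
    f₅ = odd-arc-from-odd pa s5 (proj₂ f₄)

abcbac-odd-forbidden : ∀ {a b c} → .{{NonZero a}} → .{{NonZero b}} → .{{NonZero c}} →
                       ¬ AllEven a b c → ¬ Path6 a b c b a c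
abcbac-odd-forbidden {a} {b} {c} not-even p with parity a in pa | parity b in pb | parity c in pc
... | 0ℙ | 0ℙ | 0ℙ = not-even (refl , refl , refl)
... | 1ℙ | 0ℙ | 0ℙ = odd-arc-between-evens pa s5 (even-arcʳ pb s4) (even-arcˡ pc s6) where open Path6 p
... | 0ℙ | 1ℙ | 0ℙ = odd-arc-between-evens pb s2 (even-arcʳ pa s1) (even-arcˡ pc s3) where open Path6 p
... | _  | 0ℙ | 1ℙ = odd-arc-between-evens pc s3 (even-arcʳ pb s2) (even-arcˡ pb s4) where open Path6 p
... | 0ℙ | 1ℙ | 1ℙ = odd-arc-between-evens pb s4 t3-even (even-arcˡ pa s5)
  where
  open Path6 p
  t3-even : parity t3 ≡ 0ℙ
  t3-even = proj₂ (odd-arc-from-odd pc s3 (proj₂ (odd-arc-from-even pb s2 (even-arcʳ pa s1))))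
... | 1ℙ | 1ℙ | 0ℙ = abcbac-odd-odd-even p pa pb pc
... | 1ℙ | 1ℙ | 1ℙ = abcbac-all-odd p pa pb pc

forbidden-abacbc : ∀ {a b c} → .{{NonZero a}} → .{{NonZero b}} → .{{NonZero c}} → Forbidden (a ∷ b ∷ a ∷ c ∷ b ∷ c ∷ [])
forbidden-abacbc = halving-descent (λ a b c → a ∷ b ∷ a ∷ c ∷ b ∷ c ∷ []) refl
  (λ not-even → abacbc-odd-forbidden not-even ∘ realizable⇒path6)

forbidden-abcabc : ∀ {a b c} → .{{NonZero a}} → .{{NonZero b}} → .{{NonZero c}} → Forbidden (a ∷ b ∷ c ∷ a ∷ b ∷ c ∷ [])
forbidden-abcabc = halving-descent (λ a b c → a ∷ b ∷ c ∷ a ∷ b ∷ c ∷ []) refl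
  (λ not-even → abcabc-odd-forbidden not-even ∘ realizable⇒path6)

forbidden-abcbac : ∀ {a b c} → .{{NonZero a}} → .{{NonZero b}} → .{{NonZero c}} → Forbidden (a ∷ b ∷ c ∷ b ∷ a ∷ c ∷ [])
forbidden-abcbac = halving-descent (λ a b c → a ∷ b ∷ c ∷ b ∷ a ∷ c ∷ []) refl
  (λ not-even → abcbac-odd-forbidden not-even ∘ realizable⇒path6)

forbidden-abcacb : ∀ {a b c} → .{{NonZero a}} → .{{NonZero b}} → .{{NonZero c}} → Forbidden (a ∷ b ∷ c ∷ a ∷ c ∷ b ∷ [])
forbidden-abcacb {a} {b} {c} = forbidden-abcbac {b} {c} {a} ∘ path6⇒realizable ∘ reverse6 ∘ realizable⇒path6

-- Classifying the arrangements of aabbcc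

data Obstructed {A : Set} : List A → Set where
  repeat      : ∀ {x xs} → Obstructed (x ∷ x ∷ xs)
  alternation : ∀ {x y xs} → Obstructed (x ∷ y ∷ x ∷ y ∷ xs)
  abacbc      : ∀ {x y z} → Obstructed (x ∷ y ∷ x ∷ z ∷ y ∷ z ∷ [])
  abcabc      : ∀ {x y z} → Obstructed (x ∷ y ∷ z ∷ x ∷ y ∷ z ∷ [])
  abcbac      : ∀ {x y z} → Obstructed (x ∷ y ∷ z ∷ y ∷ x ∷ z ∷ [])
  abcacb      : ∀ {x y z} → Obstructed (x ∷ y ∷ z ∷ x ∷ z ∷ y ∷ [])
  later       : ∀ {x xs} → Obstructed xs → Obstructed (x ∷ xs)

obstructed⇒forbidden : ∀ {A : Set} (g : A → ℕ) → (∀ x → NonZero (g x)) →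
                       ∀ {w} → Obstructed w → Forbidden (List.map g w)
obstructed⇒forbidden g nz (repeat {x})         = forbidden-repeat {{nz x}}
obstructed⇒forbidden g nz (alternation {x})    = forbidden-alternation {{nz x}}
obstructed⇒forbidden g nz (abacbc {x} {y} {z}) = forbidden-abacbc {{nz x}} {{nz y}} {{nz z}}
obstructed⇒forbidden g nz (abcabc {x} {y} {z}) = forbidden-abcabc {{nz x}} {{nz y}} {{nz z}}
obstructed⇒forbidden g nz (abcbac {x} {y} {z}) = forbidden-abcbac {{nz x}} {{nz y}} {{nz z}}
obstructed⇒forbidden g nz (abcacb {x} {y} {z}) = forbidden-abcacb {{nz x}} {{nz y}} {{nz z}}
obstructed⇒forbidden g nz (later o)            = forbidden-cons (obstructed⇒forbidden g nz o)

module _ {A : Set} (_≟_ : DecidableEquality A) where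

  repeat? : (w : List A) → Maybe (Obstructed w)
  repeat? (x ∷ y ∷ _) with x ≟ y
  ... | yes refl = just repeat
  ... | no _     = nothing
  repeat? _ = nothing

  alternation? : (w : List A) → Maybe (Obstructed w)
  alternation? (x ∷ y ∷ x′ ∷ y′ ∷ _) with x ≟ x′ | y ≟ y′
  ... | yes refl | yes refl = just alternation
  ... | _        | _        = nothing
  alternation? _ = nothing

  shape? : (w : List A) → Maybe (Obstructed w)
  shape? (x₁ ∷ x₂ ∷ x₃ ∷ x₄ ∷ x₅ ∷ x₆ ∷ []) with x₁ ≟ x₃ | x₂ ≟ x₅ | x₄ ≟ x₆
  ... | yes refl | yes refl | yes refl = just abacbc
  ... | _        | _        | _        with x₁ ≟ x₄ | x₂ ≟ x₅ | x₃ ≟ x₆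
  ...   | yes refl | yes refl | yes refl = just abcabc
  ...   | _        | _        | _        with x₁ ≟ x₅ | x₂ ≟ x₄ | x₃ ≟ x₆
  ...     | yes refl | yes refl | yes refl = just abcbac
  ...     | _        | _        | _        with x₁ ≟ x₄ | x₂ ≟ x₆ | x₃ ≟ x₅
  ...       | yes refl | yes refl | yes refl = just abcacb
  ...       | _        | _        | _        = nothing
  shape? _ = nothing

  obstruction : (w : List A) → Maybe (Obstructed w)
  obstruction []         = nothing
  obstruction w@(_ ∷ xs) = repeat? w <∣> alternation? w <∣> shape? w <∣> Maybe.map later (obstruction xs)

module _ {A : Set} where

  select : List A → List (A × List A)
  select []       = []
  select (x ∷ xs) = (x , xs) ∷ List.map (λ (y , ys) → y , x ∷ ys) (select xs)

  ∈-select : ∀ {y} xs → y ∈ xs → ∃ λ ys → (y , ys) ∈ select xs × xs ↭ y ∷ ys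
  ∈-select (x ∷ xs) (here refl) = xs , here refl , ↭-refl
  ∈-select {y} (x ∷ xs) (there y∈xs) with ∈-select xs y∈xs
  ... | ys , mem , xs↭y∷ys =
    x ∷ ys , there (∈-map⁺ (λ (y , ys) → y , x ∷ ys) mem) , ↭-trans (↭-prep x xs↭y∷ys) (↭-swap x y ↭-refl)

  AllPermutations : ℕ → (List A → Set) → List A → Set
  AllPermutations zero    P _  = P []
  AllPermutations (suc n) P xs = All (λ (y , ys) → AllPermutations n (λ zs → P (y ∷ zs)) ys) (select xs)

  allPermutations? : ∀ n {P : List A → Set} → Decidable P → Decidable (AllPermutations n P)
  allPermutations? zero    P? _  = P? []
  allPermutations? (suc n) P? xs = all? (λ (y , ys) → allPermutations? n (λ zs → P? (y ∷ zs)) ys) (select xs)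

  AllPermutations⇒ : ∀ n {P : List A → Set} {xs ys} → length xs ≡ n → AllPermutations n P xs → ys ↭ xs → P ys
  AllPermutations⇒ zero {xs = []} _ all ys↭[] rewrite ↭-empty-inv ys↭[] = all
  AllPermutations⇒ (suc n) {ys = []} len _ []↭xs with () ← trans (↭-length []↭xs) len
  AllPermutations⇒ (suc n) {xs = xs} {ys = y ∷ ys} len all y∷ys↭xs
    with zs , mem , xs↭y∷zs ← ∈-select xs (∈-resp-↭ y∷ys↭xs (here refl)) =
    AllPermutations⇒ n (suc-injective (trans (sym (↭-length xs↭y∷zs)) len)) (All.lookup all mem)
      (drop-mid [] [] (↭-trans y∷ys↭xs xs↭y∷zs))

doubled-letters : List (Fin 3)
doubled-letters = # 0 ∷ # 0 ∷ # 1 ∷ # 1 ∷ # 2 ∷ # 2 ∷ []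

-- Decided by evaluating obstruction on all 720 orderings of the letters.
arrangements-obstructed : AllPermutations 6 (Is-just ∘ obstruction Fin._≟_) doubled-letters
arrangements-obstructed =
  toWitness {a? = allPermutations? 6 (λ w → Any.dec (λ _ → yes tt) (obstruction Fin._≟_ w)) doubled-letters} tt

sizes : ℕ → ℕ → ℕ → Fin 3 → ℕ
sizes a b c zero             = a
sizes a b c (suc zero)       = b
sizes a b c (suc (suc zero)) = c

claim13 : (a b c : ℕ) → NonZero a → NonZero b → NonZero c →
          (p : List ℕ) → p ↭ (a ∷ a ∷ b ∷ b ∷ c ∷ c ∷ []) → Forbidden p
claim13 a b c na nb nc p p↭ with ↭-map-inv (sizes a b c) (↭-sym p↭)
... | w , refl , doubled↭w = obstructed⇒forbidden (sizes a b c) sizes-nonZero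
  (to-witness (AllPermutations⇒ 6 {Is-just ∘ obstruction Fin._≟_} refl arrangements-obstructed (↭-sym doubled↭w)))
  where
  sizes-nonZero : ∀ i → NonZero (sizes a b c i)
  sizes-nonZero zero             = na
  sizes-nonZero (suc zero)       = nb
  sizes-nonZero (suc (suc zero)) = nc
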